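{- Let $t \ge 2$ be an integer and let \[ U_t(x) = 2x^{4t-1} + x^{2t+4} - 2x^{2t+1} + 2x^{2t-1} - x^{2t-4} - 2x,\qquad W_t(x) = 2x^{4t-1} - x^{2t+4} - 2x^{2t+1} + 2x^{2t-1} + x^{2t-4} - 2x. \] For each prime $p \ge 7$, neither $U_t(x)$ nor $W_t(x)$ is divisible by $\Phi_p(x)$ or by $\Phi_{2p}(x)$.
   Context: $\Phi_b(x)$ denotes the $b$-th cyclotomic polynomial, $\Phi_b(x) = \prod_\zeta (x-\zeta)$ over the primitive $b$-th roots of unity $\zeta$. -}

module Defs where

open import Data.Nat as ℕ using (ℕ; zero; suc; _<_)
open import Data.Nat.Properties using (n<1+n; m<n⇒m<1+n)
open import Data.Nat.Divisibility using (_∣_; _∣?_)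
open import Data.Nat.Induction using (<-rec)
open import Data.Integer as ℤ using (ℤ; +_; -_)
open import Data.List using (List; []; _∷_; map; foldr; filter; reverse; replicate; _++_; length)
open import Data.Product using (Σ; ∃; _,_; proj₁; proj₂)
open import Relation.Binary.PropositionalEquality using (_≡_)
open import Relation.Nullary using (yes; no)

-- Integer polynomials as coefficient lists, lowest degree first.
Poly : Set
Poly = List ℤ

coeff : Poly → ℕ → ℤ
coeff []       _       = + 0
coeff (a ∷ _)  zero    = a
coeff (_ ∷ as) (suc i) = coeff as i

_≈ₚ_ : Poly → Poly → Set
p ≈ₚ q = ∀ i → coeff p i ≡ coeff q i

infixl 6 _+ₚ_ _-ₚ_
infixl 7 _*ₚ_
infix 4 _≈ₚ_ _∣ₚ_

_+ₚ_ : Poly → Poly → Poly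
[]       +ₚ q        = q
(a ∷ p)  +ₚ []       = a ∷ p
(a ∷ p)  +ₚ (b ∷ q)  = (a ℤ.+ b) ∷ (p +ₚ q)

negₚ : Poly → Poly
negₚ = map (-_)

_-ₚ_ : Poly → Poly → Poly
p -ₚ q = p +ₚ negₚ q

_*ₚ_ : Poly → Poly → Poly
[]      *ₚ q = []
(a ∷ p) *ₚ q = map (a ℤ.*_) q +ₚ (+ 0 ∷ (p *ₚ q))

mono : ℤ → ℕ → Poly
mono c k = replicate k (+ 0) ++ (c ∷ [])

_∣ₚ_ : Poly → Poly → Set
d ∣ₚ f = ∃ λ q → f ≈ₚ d *ₚ q

trim : Poly → Poly
trim [] = []
trim (a ∷ p) with trim p
... | b ∷ q = a ∷ b ∷ q
... | [] with a ℤ.≟ + 0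
...   | yes _ = []
...   | no  _ = a ∷ []

-- long division by a monic divisor, on big-endian coefficient lists:
-- numerator (big-endian), divisor without its leading 1 (big-endian), fuel = number of quotient coefficients
private
  subFront : List ℤ → List ℤ → List ℤ
  subFront (a ∷ as) (b ∷ bs) = (a ℤ.- b) ∷ subFront as bs
  subFront as       []       = as
  subFront []       bs       = map (-_) bs

  divB : ℕ → List ℤ → List ℤ → List ℤ
  divB zero    _        _  = []
  divB (suc k) []       _  = []
  divB (suc k) (c ∷ ns) dt = c ∷ divB k (subFront ns (map (c ℤ.*_) dt)) dt

quotMonic : Poly → Poly → Poly
quotMonic f d with reverse (trim f) | reverse (trim d)
... | fb | []      = []
... | fb | _ ∷ dt  = reverse (divB (length fb ℕ.∸ length dt) fb dt)

prodₚ : List Poly → Poly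
prodₚ = foldr _*ₚ_ (+ 1 ∷ [])

below : (n : ℕ) → List (Σ ℕ (λ d → d < n))
below zero    = []
below (suc n) = (n , n<1+n n) ∷ map (λ x → proj₁ x , m<n⇒m<1+n (proj₂ x)) (below n)

-- Cyclotomic polynomials, via  x^n - 1 = ∏_{d ∣ n} Φ_d(x):
-- Φ n = (x^n - 1) / ∏_{d ∣ n, d < n} Φ d   (meaningful for n ≥ 1)
Φ : ℕ → Poly
Φ = <-rec (λ _ → Poly) step
  where
  step : (n : ℕ) → (∀ {d} → d < n → Poly) → Poly
  step n rec = quotMonic (mono (+ 1) n -ₚ mono (+ 1) 0)
                         (prodₚ (map (λ x → rec (proj₂ x))
                                     (filter (λ x → proj₁ x ∣? n) (below n))))

U : ℕ → Poly
U t = mono (+ 2) (4 ℕ.* t ℕ.∸ 1) +ₚ mono (+ 1) (2 ℕ.* t ℕ.+ 4) -ₚ mono (+ 2) (2 ℕ.* t ℕ.+ 1)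
      +ₚ mono (+ 2) (2 ℕ.* t ℕ.∸ 1) -ₚ mono (+ 1) (2 ℕ.* t ℕ.∸ 4) -ₚ mono (+ 2) 1

W : ℕ → Poly
W t = mono (+ 2) (4 ℕ.* t ℕ.∸ 1) -ₚ mono (+ 1) (2 ℕ.* t ℕ.+ 4) -ₚ mono (+ 2) (2 ℕ.* t ℕ.+ 1)
      +ₚ mono (+ 2) (2 ℕ.* t ℕ.∸ 1) +ₚ mono (+ 1) (2 ℕ.* t ℕ.∸ 4) -ₚ mono (+ 2) 1

{-# OPTIONS --safe #-}
module Submission where

-- Everything is read modulo 2. For an odd prime p both Φ p and Φ (2p) have p coefficients, all
-- odd, while U t and W t are congruent to x^(2t+4) + x^(2t-4). If P ≡ 1 + x + ⋯ + x^(p-1)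
-- divides f = P q, then (1 + x) f ≡ (1 + x^p) q, so along each residue class of exponents modulo
-- p the coefficients of q are the partial sums of those of (1 + x) f. The latter has odd
-- coefficients only at 2t-4, 2t-3, 2t+4 and 2t+5, and as p ∤ 1, 8, 9 for p ≥ 5 the last one is
-- alone in its class; q would then have infinitely many odd coefficients.

open import Defs
open import Data.Nat using (ℕ; _≤_; _*_)
open import Data.Nat.Primality using (Prime)
open import Data.Product using (_×_)
open import Relation.Nullary using (¬_)

open import Data.Integer as ℤ using (ℤ; +_; -[1+_]; ∣_∣; _⊖_)
import Data.Integer.Properties as ℤ
open import Data.List using (List; []; _∷_; map; filter; replicate; _++_; _∷ʳ_; length; reverse)
open import Data.List.Properties
  using (length-reverse; unfold-reverse; reverse-++; length-map; map-∘; map-cong; filter-accept; filter-reject)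
open import Data.List.Relation.Unary.All as All using (All; []; _∷_)
import Data.List.Relation.Unary.Any.Properties as Any
open import Data.Nat as ℕ using (zero; suc; _+_; _∸_; _<_; _⊔_; z≤n; s≤s; parity; NonZero; nonTrivial⇒n>1)
import Data.Nat.Properties as ℕ
open import Data.Nat.Divisibility
  using (_∣_; _∣?_; divides; ∣⇒≤; >⇒∤; 1∣_; 0∣⇒≡0; ∣1⇒≡1; m∣m*n; n∣m*n; ∣m+n∣m⇒∣n)
open import Data.Nat.DivMod using (_%_; _/_; m%n<n; m≡m%n+[m/n]*n)
open import Data.Nat.Induction using (<-wellFounded)
open import Data.Nat.Primality using (prime⇒irreducible; prime⇒nonZero; prime⇒nonTrivial; euclidsLemma)
open import Data.Nat.Tactic.RingSolver using (solve-∀)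
open import Data.Parity as ℙ using (Parity; 0ℙ; 1ℙ)
import Data.Parity.Properties as ℙ
open import Data.Product using (Σ; _,_; proj₁; proj₂)
open import Data.Sum using (_⊎_; inj₁; inj₂; [_,_]′)
open import Function using (_∘′_)
open import Induction.WellFounded using (module FixPoint)
open import Relation.Binary.PropositionalEquality
open import Relation.Nullary using (yes; no; contradiction)
open import Algebra.Properties.CommutativeSemigroup ℕ.+-commutativeSemigroup using (x∙yz≈y∙xz)
open import Algebra.Properties.CommutativeSemigroup ℕ.*-commutativeSemigroup
  using () renaming (xy∙z≈xz∙y to *-xy∙z≈xz∙y)
open ≡-Reasoning

parityℤ : ℤ → Parity
parityℤ i = parity ∣ i ∣

parity-suc-+-suc : ∀ m n → parity (suc m) ℙ.+ parity (suc n) ≡ parity (m + n)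
parity-suc-+-suc m n = begin
  parity (suc m) ℙ.+ parity (suc n) ≡⟨ ℙ.+-homo-+ (suc m) (suc n) ⟨
  parity (suc m + suc n)            ≡⟨ cong (parity ∘′ suc) (ℕ.+-suc m n) ⟩
  parity (m + n)                    ∎

parity-⊖ : ∀ m n → parityℤ (m ⊖ n) ≡ parity (m + n)
parity-⊖ m       zero    = cong parity (sym (ℕ.+-identityʳ m))
parity-⊖ zero    (suc n) = refl
parity-⊖ (suc m) (suc n) = begin
  parityℤ (suc m ⊖ suc n) ≡⟨ cong parityℤ (ℤ.[1+m]⊖[1+n]≡m⊖n m n) ⟩
  parityℤ (m ⊖ n)         ≡⟨ parity-⊖ m n ⟩
  parity (m + n)          ≡⟨ cong (parity ∘′ suc) (ℕ.+-suc m n) ⟨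
  parity (suc m + suc n)  ∎

parityℤ-+ : ∀ i j → parityℤ (i ℤ.+ j) ≡ parityℤ i ℙ.+ parityℤ j
parityℤ-+ (+ m)    (+ n)    = ℙ.+-homo-+ m n
parityℤ-+ (+ m)    -[1+ n ] = trans (parity-⊖ m (suc n)) (ℙ.+-homo-+ m (suc n))
parityℤ-+ -[1+ m ] (+ n)    =
  trans (parity-⊖ n (suc m)) (trans (ℙ.+-homo-+ n (suc m)) (ℙ.+-comm (parity n) (parity (suc m))))
parityℤ-+ -[1+ m ] -[1+ n ] = sym (parity-suc-+-suc m n)

parityℤ-neg : ∀ i → parityℤ (ℤ.- i) ≡ parityℤ i
parityℤ-neg i = cong parity (ℤ.∣-i∣≡∣i∣ i)

parityℤ-* : ∀ i j → parityℤ (i ℤ.* j) ≡ parityℤ i ℙ.* parityℤ j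
parityℤ-* i j = trans (cong parity (ℤ.abs-* i j)) (ℙ.*-homo-* ∣ i ∣ ∣ j ∣)

coeff₂ : Poly → ℕ → Parity
coeff₂ f i = parityℤ (coeff f i)

OddCoefficients : Poly → Set
OddCoefficients = All (λ a → parityℤ a ≡ 1ℙ)

coeff-+ₚ : ∀ f g i → coeff (f +ₚ g) i ≡ coeff f i ℤ.+ coeff g i
coeff-+ₚ []      g       i       = sym (ℤ.+-identityˡ _)
coeff-+ₚ (a ∷ f) []      i       = sym (ℤ.+-identityʳ _)
coeff-+ₚ (a ∷ f) (b ∷ g) zero    = refl
coeff-+ₚ (a ∷ f) (b ∷ g) (suc i) = coeff-+ₚ f g i

coeff-map : ∀ (h : ℤ → ℤ) → h (+ 0) ≡ + 0 → ∀ f i → coeff (map h f) i ≡ h (coeff f i)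
coeff-map h h0 []      i       = sym h0
coeff-map h h0 (a ∷ f) zero    = refl
coeff-map h h0 (a ∷ f) (suc i) = coeff-map h h0 f i

coeff₂-+ₚ : ∀ f g i → coeff₂ (f +ₚ g) i ≡ coeff₂ f i ℙ.+ coeff₂ g i
coeff₂-+ₚ f g i = trans (cong parityℤ (coeff-+ₚ f g i)) (parityℤ-+ (coeff f i) (coeff g i))

coeff₂-negₚ : ∀ f i → coeff₂ (negₚ f) i ≡ coeff₂ f i
coeff₂-negₚ f i = trans (cong parityℤ (coeff-map ℤ.-_ refl f i)) (parityℤ-neg (coeff f i))

coeff₂--ₚ : ∀ f g i → coeff₂ (f -ₚ g) i ≡ coeff₂ f i ℙ.+ coeff₂ g i
coeff₂--ₚ f g i = trans (coeff₂-+ₚ f (negₚ g) i) (cong (coeff₂ f i ℙ.+_) (coeff₂-negₚ g i))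

coeff₂-scale : ∀ a f i → coeff₂ (map (a ℤ.*_) f) i ≡ parityℤ a ℙ.* coeff₂ f i
coeff₂-scale a f i = trans (cong parityℤ (coeff-map (a ℤ.*_) (ℤ.*-zeroʳ a) f i)) (parityℤ-* a (coeff f i))

coeff-mono-≢ : ∀ c k i → i ≢ k → coeff (mono c k) i ≡ + 0
coeff-mono-≢ c zero    zero    i≢k = contradiction refl i≢k
coeff-mono-≢ c zero    (suc i) i≢k = refl
coeff-mono-≢ c (suc k) zero    i≢k = refl
coeff-mono-≢ c (suc k) (suc i) i≢k = coeff-mono-≢ c k i (i≢k ∘′ cong suc)

coeff-mono-≡ : ∀ c k → coeff (mono c k) k ≡ c
coeff-mono-≡ c zero    = refl
coeff-mono-≡ c (suc k) = coeff-mono-≡ c k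

coeff₂-mono-even : ∀ c k i → parityℤ c ≡ 0ℙ → coeff₂ (mono c k) i ≡ 0ℙ
coeff₂-mono-even c k i c-even with i ℕ.≟ k
... | yes refl = trans (cong parityℤ (coeff-mono-≡ c k)) c-even
... | no i≢k   = cong parityℤ (coeff-mono-≢ c k i i≢k)

coeff₂-mono-≢ : ∀ {k i} → i ≢ k → coeff₂ (mono (+ 1) k) i ≡ 0ℙ
coeff₂-mono-≢ {k} {i} i≢k = cong parityℤ (coeff-mono-≢ (+ 1) k i i≢k)

coeff₂-mono-≡ : ∀ k → coeff₂ (mono (+ 1) k) k ≡ 1ℙ
coeff₂-mono-≡ k = cong parityℤ (coeff-mono-≡ (+ 1) k)

coeff-beyond : ∀ f i → length f ≤ i → coeff f i ≡ + 0
coeff-beyond []      i       _         = refl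
coeff-beyond (a ∷ f) (suc i) (s≤s f≤i) = coeff-beyond f i f≤i

shiftₚ : ℕ → Poly → Poly
shiftₚ n q = replicate n (+ 0) ++ q

coeff-shiftₚ-< : ∀ n q i → i < n → coeff (shiftₚ n q) i ≡ + 0
coeff-shiftₚ-< (suc n) q zero    _         = refl
coeff-shiftₚ-< (suc n) q (suc i) (s≤s i<n) = coeff-shiftₚ-< n q i i<n

coeff-shiftₚ-+ : ∀ n q i → coeff (shiftₚ n q) (n + i) ≡ coeff q i
coeff-shiftₚ-+ zero    q i = refl
coeff-shiftₚ-+ (suc n) q i = coeff-shiftₚ-+ n q i

-- The coefficient of x^i in (1 + x + ⋯ + x^(n-1)) q, modulo 2.
windowSum : ℕ → Poly → ℕ → Parity
windowSum zero    q i       = 0ℙ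
windowSum (suc n) q zero    = coeff₂ q zero
windowSum (suc n) q (suc i) = coeff₂ q (suc i) ℙ.+ windowSum n q i

coeff₂-*ₚ-odd : ∀ {P} → OddCoefficients P → ∀ q i → coeff₂ (P *ₚ q) i ≡ windowSum (length P) q i
coeff₂-*ₚ-odd []                   q i = refl
coeff₂-*ₚ-odd {a ∷ P} (a-odd ∷ P-odd) q i = begin
  coeff₂ ((a ∷ P) *ₚ q) i
    ≡⟨ coeff₂-+ₚ (map (a ℤ.*_) q) (+ 0 ∷ (P *ₚ q)) i ⟩
  coeff₂ (map (a ℤ.*_) q) i ℙ.+ coeff₂ (+ 0 ∷ (P *ₚ q)) i
    ≡⟨ cong (ℙ._+ coeff₂ (+ 0 ∷ (P *ₚ q)) i) (trans (coeff₂-scale a q i) (cong (ℙ._* coeff₂ q i) a-odd)) ⟩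
  coeff₂ q i ℙ.+ coeff₂ (+ 0 ∷ (P *ₚ q)) i
    ≡⟨ lower i ⟩
  windowSum (suc (length P)) q i ∎
  where
  lower : ∀ i → coeff₂ q i ℙ.+ coeff₂ (+ 0 ∷ (P *ₚ q)) i ≡ windowSum (suc (length P)) q i
  lower zero    = ℙ.+-identityʳ (coeff₂ q zero)
  lower (suc i) = cong (coeff₂ q (suc i) ℙ.+_) (coeff₂-*ₚ-odd P-odd q i)

windowSum-suc : ∀ n q i → windowSum (suc n) q i ≡ windowSum n q i ℙ.+ coeff₂ (shiftₚ n q) i
windowSum-suc zero    q zero    = refl
windowSum-suc zero    q (suc i) = ℙ.+-identityʳ (coeff₂ q (suc i))
windowSum-suc (suc n) q zero    = sym (ℙ.+-identityʳ (coeff₂ q zero))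
windowSum-suc (suc n) q (suc i) = trans (cong (coeff₂ q (suc i) ℙ.+_) (windowSum-suc n q i))
                                        (sym (ℙ.+-assoc (coeff₂ q (suc i)) (windowSum n q i) _))

a+w+[w+s]≡a+s : ∀ a w s → (a ℙ.+ w) ℙ.+ (w ℙ.+ s) ≡ a ℙ.+ s
a+w+[w+s]≡a+s a w s = begin
  (a ℙ.+ w) ℙ.+ (w ℙ.+ s) ≡⟨ ℙ.+-assoc a w (w ℙ.+ s) ⟩
  a ℙ.+ (w ℙ.+ (w ℙ.+ s)) ≡⟨ cong (a ℙ.+_) (ℙ.+-assoc w w s) ⟨
  a ℙ.+ ((w ℙ.+ w) ℙ.+ s) ≡⟨ cong (λ z → a ℙ.+ (z ℙ.+ s)) (ℙ.p+p≡0ℙ w) ⟩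
  a ℙ.+ s                 ∎

x≡y+z⇒y≡x+z : ∀ {x y z} → x ≡ y ℙ.+ z → y ≡ x ℙ.+ z
x≡y+z⇒y≡x+z {y = y} {z} refl = sym (begin
  y ℙ.+ z ℙ.+ z   ≡⟨ ℙ.+-assoc y z z ⟩
  y ℙ.+ (z ℙ.+ z) ≡⟨ cong (y ℙ.+_) (ℙ.p+p≡0ℙ z) ⟩
  y ℙ.+ 0ℙ        ≡⟨ ℙ.+-identityʳ y ⟩
  y               ∎)

windowSum-zero : ∀ n q → windowSum n q zero ≡ coeff₂ q zero ℙ.+ coeff₂ (shiftₚ n q) zero
windowSum-zero zero    q = sym (ℙ.p+p≡0ℙ (coeff₂ q zero))
windowSum-zero (suc n) q = sym (ℙ.+-identityʳ (coeff₂ q zero))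

windowSum-difference : ∀ n q i →
  windowSum n q (suc i) ℙ.+ windowSum n q i ≡ coeff₂ q (suc i) ℙ.+ coeff₂ (shiftₚ n q) (suc i)
windowSum-difference zero    q i = sym (ℙ.p+p≡0ℙ (coeff₂ q (suc i)))
windowSum-difference (suc n) q i = trans (cong (coeff₂ q (suc i) ℙ.+ windowSum n q i ℙ.+_) (windowSum-suc n q i))
                                         (a+w+[w+s]≡a+s (coeff₂ q (suc i)) (windowSum n q i) _)

[1+x]*ₚ_ : Poly → Poly
[1+x]*ₚ f = f +ₚ (+ 0 ∷ f)

[1+x]f≡[1+xⁿ]q : ∀ {P f q} → OddCoefficients P → f ≈ₚ P *ₚ q → ∀ j →
  coeff₂ ([1+x]*ₚ f) j ≡ coeff₂ q j ℙ.+ coeff₂ (shiftₚ (length P) q) j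
[1+x]f≡[1+xⁿ]q {P} {f} {q} P-odd f≈Pq j = trans (coeff₂-+ₚ f (+ 0 ∷ f) j) (split j)
  where
  window : ∀ i → coeff₂ f i ≡ windowSum (length P) q i
  window i = trans (cong parityℤ (f≈Pq i)) (coeff₂-*ₚ-odd P-odd q i)

  split : ∀ j → coeff₂ f j ℙ.+ coeff₂ (+ 0 ∷ f) j ≡ coeff₂ q j ℙ.+ coeff₂ (shiftₚ (length P) q) j
  split zero    = trans (ℙ.+-identityʳ _) (trans (window zero) (windowSum-zero (length P) q))
  split (suc j) = trans (cong₂ ℙ._+_ (window (suc j)) (window j)) (windowSum-difference (length P) q j)

partialSums-eventually-1ℙ : ∀ (Q G : ℕ → Parity) K →
  Q zero ≡ G zero → (∀ k → Q (suc k) ≡ G (suc k) ℙ.+ Q k) →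
  (∀ k → k ≢ K → G k ≡ 0ℙ) → G K ≡ 1ℙ → ∀ m → Q (m + K) ≡ 1ℙ
partialSums-eventually-1ℙ Q G K Q₀ Q-suc G-off G-on = after
  where
  before : ∀ k → k < K → Q k ≡ 0ℙ
  before zero    0<K   = trans Q₀ (G-off zero (ℕ.<⇒≢ 0<K))
  before (suc k) 1+k<K =
    trans (Q-suc k) (cong₂ ℙ._+_ (G-off (suc k) (ℕ.<⇒≢ 1+k<K)) (before k (ℕ.<-trans (ℕ.n<1+n k) 1+k<K)))

  atK : Q K ≡ 1ℙ
  atK = reach K G-on before
    where
    reach : ∀ k → G k ≡ 1ℙ → (∀ i → i < k → Q i ≡ 0ℙ) → Q k ≡ 1ℙ
    reach zero    G₀≡1 _   = trans Q₀ G₀≡1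
    reach (suc k) Gk≡1 Q<k = trans (Q-suc k) (cong₂ ℙ._+_ Gk≡1 (Q<k k (ℕ.n<1+n k)))

  after : ∀ m → Q (m + K) ≡ 1ℙ
  after zero    = atK
  after (suc m) = trans (Q-suc (m + K)) (cong₂ ℙ._+_ (G-off (suc m + K) (≢-sym (ℕ.m≢1+n+m K))) (after m))

residue-gap : ∀ n .{{_ : NonZero n}} s k d → s % n + k * n + d ≡ s → n ∣ d
residue-gap n s k d r+kn+d≡s = ∣m+n∣m⇒∣n (divides (s / n) kn+d≡[s/n]n) (n∣m*n k)
  where
  kn+d≡[s/n]n : k * n + d ≡ s / n * n
  kn+d≡[s/n]n = ℕ.+-cancelˡ-≡ (s % n) _ _
    (trans (sym (ℕ.+-assoc (s % n) (k * n) d)) (trans r+kn+d≡s (m≡m%n+[m/n]*n s n)))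

residue-quotient : ∀ n .{{_ : NonZero n}} s k → s % n + k * n ≡ s → k ≡ s / n
residue-quotient n s k r+kn≡s =
  ℕ.*-cancelʳ-≡ k (s / n) n (ℕ.+-cancelˡ-≡ (s % n) _ _ (trans r+kn≡s (m≡m%n+[m/n]*n s n)))

-- Along r, r + n, r + 2n, … the parities of q are, by [1+x]f≡[1+xⁿ]q, the partial sums of
-- those of (1 + x) f; an isolated odd term makes them eventually odd, which no polynomial allows.
isolatedOdd⇒¬∣ : ∀ {P f} r K → OddCoefficients P → r < length P →
  (∀ k → k ≢ K → coeff₂ ([1+x]*ₚ f) (r + k * length P) ≡ 0ℙ) →
  coeff₂ ([1+x]*ₚ f) (r + K * length P) ≡ 1ℙ →
  ¬ P ∣ₚ f
isolatedOdd⇒¬∣ {P} {f} r K P-odd r<n G-off G-on (q , f≈Pq) =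
  0ℙ≢1ℙ (trans (sym Q-beyond) (partialSums-eventually-1ℙ Q G K Q₀ Q-suc G-off G-on (length q)))
  where
  n = length P

  G Q : ℕ → Parity
  G k = coeff₂ ([1+x]*ₚ f) (r + k * n)
  Q k = coeff₂ q (r + k * n)

  q-recurrence : ∀ x → coeff₂ q x ≡ coeff₂ ([1+x]*ₚ f) x ℙ.+ coeff₂ (shiftₚ n q) x
  q-recurrence x = x≡y+z⇒y≡x+z ([1+x]f≡[1+xⁿ]q {f = f} P-odd f≈Pq x)

  Q₀ : Q zero ≡ G zero
  Q₀ = trans (q-recurrence (r + 0))
    (trans (cong (λ c → G zero ℙ.+ parityℤ c) (coeff-shiftₚ-< n q (r + 0) r+0<n)) (ℙ.+-identityʳ (G zero)))
    where
    r+0<n : r + 0 < n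
    r+0<n = subst (_< n) (sym (ℕ.+-identityʳ r)) r<n

  Q-suc : ∀ k → Q (suc k) ≡ G (suc k) ℙ.+ Q k
  Q-suc k = trans (q-recurrence (r + suc k * n))
    (cong (λ x → G (suc k) ℙ.+ parityℤ x)
      (trans (cong (coeff (shiftₚ n q)) (x∙yz≈y∙xz r n (k * n))) (coeff-shiftₚ-+ n q (r + k * n))))

  Q-beyond : Q (length q + K) ≡ 0ℙ
  Q-beyond = cong parityℤ (coeff-beyond q (r + (length q + K) * n)
    (ℕ.≤-trans (ℕ.m≤m+n (length q) K) (ℕ.≤-trans (ℕ.m≤m*n (length q + K) n) (ℕ.m≤n+m ((length q + K) * n) r))))
    where
    instance _ = ℕ.>-nonZero (ℕ.≤-<-trans z≤n r<n)

  0ℙ≢1ℙ : 0ℙ ≢ 1ℙ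
  0ℙ≢1ℙ ()

-- (1 + x) f is odd at most at a, 1 + a, a + g and s = 1 + a + g; the divisibility hypotheses
-- make s the only one of them in its residue class modulo n.
¬odd∣twoTerms : ∀ {P f n} a g {b} → a + g ≡ b →
  OddCoefficients P → length P ≡ n → 1 < n → ¬ n ∣ g → ¬ n ∣ suc g →
  (∀ i → coeff₂ f i ≡ coeff₂ (mono (+ 1) b) i ℙ.+ coeff₂ (mono (+ 1) a) i) →
  ¬ P ∣ₚ f
¬odd∣twoTerms {P} {f} {n} a g refl P-odd refl 1<n n∤g n∤1+g f-mod2 =
  isolatedOdd⇒¬∣ {f = f} (s % n) (s / n) P-odd (m%n<n s n) G-off G-on
  where
  instance
    n≢0 : NonZero n
    n≢0 = ℕ.>-nonZero (ℕ.<-trans (s≤s z≤n) 1<n)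

  s : ℕ
  s = suc (a + g)

  δ : ℕ → ℕ → Parity
  δ k x = coeff₂ (mono (+ 1) k) x

  [1+x]f-mod2 : ∀ x → coeff₂ ([1+x]*ₚ f) x ≡ (δ (a + g) x ℙ.+ δ a x) ℙ.+ (δ s x ℙ.+ δ (suc a) x)
  [1+x]f-mod2 x = trans (coeff₂-+ₚ f (+ 0 ∷ f) x) (cong₂ ℙ._+_ (f-mod2 x) (x*f-mod2 x))
    where
    x*f-mod2 : ∀ x → coeff₂ (+ 0 ∷ f) x ≡ δ s x ℙ.+ δ (suc a) x
    x*f-mod2 zero    = refl
    x*f-mod2 (suc x) = f-mod2 x

  G-isolated : ∀ k → coeff₂ ([1+x]*ₚ f) (s % n + k * n) ≡ δ s (s % n + k * n)
  G-isolated k = begin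
    coeff₂ ([1+x]*ₚ f) x                      ≡⟨ [1+x]f-mod2 x ⟩
    (δ (a + g) x ℙ.+ δ a x) ℙ.+ (δ s x ℙ.+ δ (suc a) x)
      ≡⟨ cong₂ ℙ._+_ (cong₂ ℙ._+_ (coeff₂-mono-≢ x≢a+g) (coeff₂-mono-≢ x≢a))
                     (cong (δ s x ℙ.+_) (coeff₂-mono-≢ x≢1+a)) ⟩
    δ s x ℙ.+ 0ℙ                              ≡⟨ ℙ.+-identityʳ (δ s x) ⟩
    δ s x                                     ∎
    where
    x = s % n + k * n
    x≢a+g : x ≢ a + g
    x≢a+g e = ℕ.<⇒≢ 1<n (sym (∣1⇒≡1 (residue-gap n s k 1 (trans (ℕ.+-comm x 1) (cong suc e)))))
    x≢a : x ≢ a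
    x≢a e = n∤1+g (residue-gap n s k (suc g) (trans (cong (_+ suc g) e) (ℕ.+-suc a g)))
    x≢1+a : x ≢ suc a
    x≢1+a e = n∤g (residue-gap n s k g (cong (_+ g) e))

  G-off : ∀ k → k ≢ s / n → coeff₂ ([1+x]*ₚ f) (s % n + k * n) ≡ 0ℙ
  G-off k k≢K = trans (G-isolated k) (coeff₂-mono-≢ (k≢K ∘′ residue-quotient n s k))

  G-on : coeff₂ ([1+x]*ₚ f) (s % n + s / n * n) ≡ 1ℙ
  G-on = trans (G-isolated (s / n)) (subst (λ x → δ s x ≡ 1ℙ) (m≡m%n+[m/n]*n s n) (coeff₂-mono-≡ s))

-- Defs keeps its long-division helpers private; unification against the normal form of quotMonic
-- in the next two equations solves these metavariables to them.
mutual
  longDivision : ℕ → List ℤ → List ℤ → List ℤ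
  longDivision = _

  subtractScaled : ℤ → List ℤ → List ℤ → List ℤ
  subtractScaled = _

  quotMonic-longDivision : ∀ f d e dt → reverse (trim d) ≡ e ∷ dt →
    quotMonic f d ≡ reverse (longDivision (length (reverse (trim f)) ∸ length dt) (reverse (trim f)) dt)
  quotMonic-longDivision f d e dt rev-d with reverse (trim f) | reverse (trim d)
  quotMonic-longDivision f d e dt refl | fb | _ with length fb ∸ length dt
  ... | k with reverse {A = ℤ}
  ... | rev = refl

  longDivision-suc : ∀ k c ns dt →
    longDivision (suc k) (c ∷ ns) dt ≡ c ∷ longDivision k (subtractScaled c ns dt) dt
  longDivision-suc k c ns dt = refl

coeff₂-subtractScaled : ∀ c ns bs i → coeff₂ (subtractScaled c ns bs) i ≡ coeff₂ ns i ℙ.+ (parityℤ c ℙ.* coeff₂ bs i)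
coeff₂-subtractScaled c (a ∷ ns) (b ∷ bs) zero    = begin
  parityℤ (a ℤ.+ ℤ.- (c ℤ.* b))          ≡⟨ parityℤ-+ a (ℤ.- (c ℤ.* b)) ⟩
  parityℤ a ℙ.+ parityℤ (ℤ.- (c ℤ.* b)) ≡⟨ cong (parityℤ a ℙ.+_) (trans (parityℤ-neg (c ℤ.* b)) (parityℤ-* c b)) ⟩
  parityℤ a ℙ.+ (parityℤ c ℙ.* parityℤ b) ∎
coeff₂-subtractScaled c (a ∷ ns) (b ∷ bs) (suc i) = coeff₂-subtractScaled c ns bs i
coeff₂-subtractScaled c (a ∷ ns) []       i       =
  sym (trans (cong (coeff₂ (a ∷ ns) i ℙ.+_) (ℙ.*-zeroʳ (parityℤ c))) (ℙ.+-identityʳ _))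
coeff₂-subtractScaled c []       []       i       = sym (ℙ.*-zeroʳ (parityℤ c))
coeff₂-subtractScaled c []       (b ∷ bs) i       =
  trans (coeff₂-negₚ (map (c ℤ.*_) (b ∷ bs)) i) (coeff₂-scale c (b ∷ bs) i)

length-subtractScaled : ∀ c ns bs → length ns ≤ length (subtractScaled c ns bs)
length-subtractScaled c (a ∷ ns) (b ∷ bs) = s≤s (length-subtractScaled c ns bs)
length-subtractScaled c (a ∷ ns) []       = ℕ.≤-refl
length-subtractScaled c []       bs       = z≤n

-- On reversed coefficient lists and modulo 2 this is 1 / (1 + y) ≡ 1 + y + ⋯ + y^k (mod y^(k+1)).
longDivision-odd : ∀ k fb dt → suc k ≤ length fb →
  (∀ i → i ≤ k → coeff₂ fb i ≡ coeff₂ (+ 1 ∷ []) i) →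
  (∀ i → i < k → coeff₂ dt i ≡ coeff₂ (+ 1 ∷ []) i) →
  OddCoefficients (longDivision (suc k) fb dt) × length (longDivision (suc k) fb dt) ≡ suc k
longDivision-odd zero    (c ∷ ns) dt _            fb≡1 _    = (fb≡1 zero z≤n ∷ []) , refl
longDivision-odd (suc k) (c ∷ ns) dt (s≤s 1+k≤ns) fb≡1 dt≡1 =
  (fb≡1 zero z≤n ∷ proj₁ rest) , cong suc (proj₂ rest)
  where
  ns′ = subtractScaled c ns dt

  ns′≡1 : ∀ i → i ≤ k → coeff₂ ns′ i ≡ coeff₂ (+ 1 ∷ []) i
  ns′≡1 i i≤k = begin
    coeff₂ ns′ i                              ≡⟨ coeff₂-subtractScaled c ns dt i ⟩
    coeff₂ ns i ℙ.+ (parityℤ c ℙ.* coeff₂ dt i)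
      ≡⟨ cong₂ (λ u v → u ℙ.+ (v ℙ.* coeff₂ dt i)) (fb≡1 (suc i) (s≤s i≤k)) (fb≡1 zero z≤n) ⟩
    coeff₂ dt i                               ≡⟨ dt≡1 i (s≤s i≤k) ⟩
    coeff₂ (+ 1 ∷ []) i                       ∎

  rest = longDivision-odd k ns′ dt (ℕ.≤-trans 1+k≤ns (length-subtractScaled c ns dt)) ns′≡1
           (λ i i<k → dt≡1 i (ℕ.<-trans i<k (ℕ.n<1+n k)))

All-reverse : ∀ {P : ℤ → Set} {xs} → All P xs → All P (reverse xs)
All-reverse pxs = All.tabulate (λ x∈rev → All.lookup pxs (Any.reverse⁻ x∈rev))

coeff-++ˡ : ∀ xs ys i → i < length xs → coeff (xs ++ ys) i ≡ coeff xs i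
coeff-++ˡ (x ∷ xs) ys zero    _         = refl
coeff-++ˡ (x ∷ xs) ys (suc i) (s≤s i<n) = coeff-++ˡ xs ys i i<n

coeff-++-length : ∀ xs y ys → coeff (xs ++ y ∷ ys) (length xs) ≡ y
coeff-++-length []       y ys = refl
coeff-++-length (x ∷ xs) y ys = coeff-++-length xs y ys

coeff-reverse : ∀ L i j → suc (i + j) ≡ length L → coeff (reverse L) i ≡ coeff L j
coeff-reverse (x ∷ xs) i zero    i+1≡len = begin
  coeff (reverse (x ∷ xs)) i            ≡⟨ cong (λ l → coeff l i) (unfold-reverse x xs) ⟩
  coeff (reverse xs ++ x ∷ []) i        ≡⟨ cong (coeff (reverse xs ++ x ∷ [])) i≡len ⟩
  coeff (reverse xs ++ x ∷ []) (length (reverse xs)) ≡⟨ coeff-++-length (reverse xs) x [] ⟩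
  x                                     ∎
  where
  i≡len : i ≡ length (reverse xs)
  i≡len = trans (sym (ℕ.+-identityʳ i)) (trans (ℕ.suc-injective i+1≡len) (sym (length-reverse xs)))
coeff-reverse (x ∷ xs) i (suc j) i+j+2≡len = begin
  coeff (reverse (x ∷ xs)) i     ≡⟨ cong (λ l → coeff l i) (unfold-reverse x xs) ⟩
  coeff (reverse xs ++ x ∷ []) i ≡⟨ coeff-++ˡ (reverse xs) (x ∷ []) i i<len ⟩
  coeff (reverse xs) i           ≡⟨ coeff-reverse xs i j i+j+1≡len ⟩
  coeff xs j                     ∎
  where
  i+j+1≡len : suc (i + j) ≡ length xs
  i+j+1≡len = trans (sym (ℕ.+-suc i j)) (ℕ.suc-injective i+j+2≡len)

  i<len : i < length (reverse xs)
  i<len = subst (i <_) (trans i+j+1≡len (sym (length-reverse xs))) (s≤s (ℕ.m≤m+n i j))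

trim-nonzeroTop : ∀ L m → length L ≡ suc m → coeff L m ≢ + 0 → trim L ≡ L
trim-nonzeroTop (a ∷ [])    zero    refl a≢0 with a ℤ.≟ + 0
... | yes a≡0 = contradiction a≡0 a≢0
... | no _    = refl
trim-nonzeroTop (a ∷ b ∷ L) (suc m) len top≢0
  rewrite trim-nonzeroTop (b ∷ L) m (ℕ.suc-injective len) top≢0 = refl

length-+ₚ : ∀ f g → length (f +ₚ g) ≡ length f ⊔ length g
length-+ₚ []      g       = refl
length-+ₚ (a ∷ f) []      = refl
length-+ₚ (a ∷ f) (b ∷ g) = cong suc (length-+ₚ f g)

length-*ₚ : ∀ a P q → 1 ≤ length q → length ((a ∷ P) *ₚ q) ≡ length P + length q
length-*ₚ a []      q 1≤q = trans (length-+ₚ (map (a ℤ.*_) q) (+ 0 ∷ []))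
  (trans (cong (_⊔ 1) (length-map (a ℤ.*_) q)) (ℕ.m≥n⇒m⊔n≡m 1≤q))
length-*ₚ a (b ∷ P) q 1≤q = trans (length-+ₚ (map (a ℤ.*_) q) (+ 0 ∷ ((b ∷ P) *ₚ q)))
  (trans (cong₂ _⊔_ (length-map (a ℤ.*_) q) (cong suc (length-*ₚ b P q 1≤q)))
    (ℕ.m≤n⇒m⊔n≡n (ℕ.≤-trans (ℕ.m≤n+m (length q) (length P)) (ℕ.n≤1+n _))))

quotMonic-odd : ∀ {f d} k n → trim f ≡ f → trim d ≡ d → length d ≡ suc n → length f ≡ suc (k + n) →
  (∀ i → i ≤ k → coeff₂ (reverse f) i ≡ coeff₂ (+ 1 ∷ []) i) →
  (∀ i → i < k → coeff₂ (reverse d) (suc i) ≡ coeff₂ (+ 1 ∷ []) i) →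
  OddCoefficients (quotMonic f d) × length (quotMonic f d) ≡ suc k
quotMonic-odd {f} {d} k n trim-f trim-d len-d len-f fb≡1 dt≡1 with reverse d in rev-d | length-reverse d
... | []     | len-rev = contradiction (trans len-rev len-d) λ ()
... | e ∷ dt | len-rev
  rewrite quotMonic-longDivision f d e dt (trans (cong reverse trim-d) rev-d) | trim-f | length-reverse f
        | len-f | ℕ.suc-injective (trans len-rev len-d) | ℕ.m+n∸n≡m (suc k) n =
  All-reverse (proj₁ quotient) , trans (length-reverse (longDivision (suc k) (reverse f) dt)) (proj₂ quotient)
  where
  1+k≤f : suc k ≤ length (reverse f)
  1+k≤f = subst (suc k ≤_) (sym (trans (length-reverse f) len-f)) (s≤s (ℕ.m≤m+n k n))

  quotient = longDivision-odd k (reverse f) dt 1+k≤f fb≡1 dt≡1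

length-mono : ∀ c m → length (mono c m) ≡ suc m
length-mono c zero    = refl
length-mono c (suc m) = cong suc (length-mono c m)

replicate-∷ʳ : ∀ n (x : ℤ) → replicate n x ∷ʳ x ≡ x ∷ replicate n x
replicate-∷ʳ zero    x = refl
replicate-∷ʳ (suc n) x = cong (x ∷_) (replicate-∷ʳ n x)

reverse-replicate : ∀ n (x : ℤ) → reverse (replicate n x) ≡ replicate n x
reverse-replicate zero    x = refl
reverse-replicate (suc n) x = begin
  reverse (x ∷ replicate n x)   ≡⟨ unfold-reverse x (replicate n x) ⟩
  reverse (replicate n x) ∷ʳ x  ≡⟨ cong (_∷ʳ x) (reverse-replicate n x) ⟩
  replicate n x ∷ʳ x            ≡⟨ replicate-∷ʳ n x ⟩
  x ∷ replicate n x             ∎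

reverse-mono : ∀ c m → reverse (mono c m) ≡ c ∷ replicate m (+ 0)
reverse-mono c m = trans (reverse-++ (replicate m (+ 0)) (c ∷ [])) (cong (c ∷_) (reverse-replicate m (+ 0)))

xⁿ-1 : ℕ → Poly
xⁿ-1 n = mono (+ 1) n -ₚ mono (+ 1) 0

xⁿ-1-suc : ∀ m → xⁿ-1 (suc m) ≡ -[1+ 0 ] ∷ mono (+ 1) m
xⁿ-1-suc m = cong (-[1+ 0 ] ∷_) (+ₚ-identityʳ (mono (+ 1) m))
  where
  +ₚ-identityʳ : ∀ f → f +ₚ [] ≡ f
  +ₚ-identityʳ []      = refl
  +ₚ-identityʳ (a ∷ f) = refl

length-xⁿ-1 : ∀ n → length (xⁿ-1 n) ≡ suc n
length-xⁿ-1 zero    = refl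
length-xⁿ-1 (suc m) = trans (cong length (xⁿ-1-suc m)) (cong suc (length-mono (+ 1) m))

trim-xⁿ-1 : ∀ n .{{_ : NonZero n}} → trim (xⁿ-1 n) ≡ xⁿ-1 n
trim-xⁿ-1 (suc m) = trim-nonzeroTop (xⁿ-1 (suc m)) (suc m) (length-xⁿ-1 (suc m)) top≢0
  where
  top≢0 : coeff (xⁿ-1 (suc m)) (suc m) ≢ + 0
  top≢0 top≡0 with () ← trans (sym (coeff-mono-≡ (+ 1) m)) (subst (λ l → coeff l (suc m) ≡ + 0) (xⁿ-1-suc m) top≡0)

reverse-xⁿ-1 : ∀ m → reverse (xⁿ-1 (suc m)) ≡ + 1 ∷ mono -[1+ 0 ] m
reverse-xⁿ-1 m = begin
  reverse (xⁿ-1 (suc m))             ≡⟨ cong reverse (xⁿ-1-suc m) ⟩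
  reverse (-[1+ 0 ] ∷ mono (+ 1) m)  ≡⟨ unfold-reverse -[1+ 0 ] (mono (+ 1) m) ⟩
  reverse (mono (+ 1) m) ∷ʳ -[1+ 0 ] ≡⟨ cong (_∷ʳ -[1+ 0 ]) (reverse-mono (+ 1) m) ⟩
  + 1 ∷ mono -[1+ 0 ] m              ∎

coeff₂-reverse-xⁿ-1 : ∀ n i → i < n → coeff₂ (reverse (xⁿ-1 n)) i ≡ coeff₂ (+ 1 ∷ []) i
coeff₂-reverse-xⁿ-1 (suc m) zero    _         rewrite reverse-xⁿ-1 m = refl
coeff₂-reverse-xⁿ-1 (suc m) (suc i) (s≤s i<m) rewrite reverse-xⁿ-1 m =
  cong parityℤ (coeff-mono-≢ -[1+ 0 ] m i (ℕ.<⇒≢ i<m))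

x²-1 : Poly
x²-1 = -[1+ 0 ] ∷ + 0 ∷ + 1 ∷ []

windowSum-x²-1-inner : ∀ k j → 2 + j ≤ k → windowSum (suc k) x²-1 (2 + j) ≡ 0ℙ
windowSum-x²-1-inner (suc (suc k)) zero    _            = refl
windowSum-x²-1-inner (suc k)       (suc j) (s≤s 3+j≤k) = windowSum-x²-1-inner k j 3+j≤k

windowSum-x²-1-top : ∀ m → windowSum (suc m) x²-1 (2 + m) ≡ 1ℙ
windowSum-x²-1-top zero    = refl
windowSum-x²-1-top (suc m) = windowSum-x²-1-top m

windowSum-x²-1-belowTop : ∀ m → windowSum (2 + m) x²-1 (2 + m) ≡ 1ℙ
windowSum-x²-1-belowTop zero    = refl
windowSum-x²-1-belowTop (suc m) = windowSum-x²-1-belowTop m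

length-*ₚ-x²-1 : ∀ P {m} → length P ≡ 2 + m → length (P *ₚ x²-1) ≡ 4 + m
length-*ₚ-x²-1 (a ∷ P) {m} len =
  trans (length-*ₚ a P x²-1 (s≤s z≤n)) (trans (cong (_+ 3) (ℕ.suc-injective len)) (ℕ.+-comm (suc m) 3))

-- Modulo 2, P (x² - 1) ≡ (1 + ⋯ + x^(m+1)) (1 + x²) ≡ 1 + x + x^(m+2) + x^(m+3).
module _ {P : Poly} (m : ℕ) (P-odd : OddCoefficients P) (len-P : length P ≡ 2 + m) where
  private
    coeff₂-P*x²-1 : ∀ j → coeff₂ (P *ₚ x²-1) j ≡ windowSum (2 + m) x²-1 j
    coeff₂-P*x²-1 j = subst (λ n → coeff₂ (P *ₚ x²-1) j ≡ windowSum n x²-1 j) len-P (coeff₂-*ₚ-odd P-odd x²-1 j)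

  trim-*ₚx²-1 : trim (P *ₚ x²-1) ≡ P *ₚ x²-1
  trim-*ₚx²-1 = trim-nonzeroTop (P *ₚ x²-1) (3 + m) (length-*ₚ-x²-1 P len-P) top≢0
    where
    top≢0 : coeff (P *ₚ x²-1) (3 + m) ≢ + 0
    top≢0 top≡0 with () ← trans (sym (cong parityℤ top≡0)) (trans (coeff₂-P*x²-1 (3 + m)) (windowSum-x²-1-top (suc m)))

  coeff₂-reverse-*ₚx²-1 : ∀ i → i < suc m → coeff₂ (reverse (P *ₚ x²-1)) (suc i) ≡ coeff₂ (+ 1 ∷ []) i
  coeff₂-reverse-*ₚx²-1 zero    _   = begin
    coeff₂ (reverse (P *ₚ x²-1)) 1
      ≡⟨ cong parityℤ (coeff-reverse (P *ₚ x²-1) 1 (2 + m) (sym (length-*ₚ-x²-1 P len-P))) ⟩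
    coeff₂ (P *ₚ x²-1) (2 + m)     ≡⟨ coeff₂-P*x²-1 (2 + m) ⟩
    windowSum (2 + m) x²-1 (2 + m) ≡⟨ windowSum-x²-1-belowTop m ⟩
    1ℙ                             ∎
  coeff₂-reverse-*ₚx²-1 (suc i) (s≤s i<m) = begin
    coeff₂ (reverse (P *ₚ x²-1)) (2 + i) ≡⟨ cong parityℤ (coeff-reverse (P *ₚ x²-1) (2 + i) (2 + d) index-sum) ⟩
    coeff₂ (P *ₚ x²-1) (2 + d)           ≡⟨ coeff₂-P*x²-1 (2 + d) ⟩
    windowSum (2 + m) x²-1 (2 + d)       ≡⟨ windowSum-x²-1-inner (suc m) d 2+d≤1+m ⟩
    0ℙ                                   ∎
    where
    d = proj₁ (ℕ.m≤n⇒∃[o]m+o≡n i<m)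
    1+i+d≡m : suc (i + d) ≡ m
    1+i+d≡m = proj₂ (ℕ.m≤n⇒∃[o]m+o≡n i<m)
    2+d≤1+m : 2 + d ≤ suc m
    2+d≤1+m = s≤s (subst (suc d ≤_) 1+i+d≡m (s≤s (ℕ.m≤n+m d i)))
    index-sum : suc (2 + i + (2 + d)) ≡ length (P *ₚ x²-1)
    index-sum = trans (cong (λ x → 3 + x) (trans (ℕ.+-suc i (suc d)) (cong suc (ℕ.+-suc i d))))
                      (trans (cong (λ x → 4 + x) 1+i+d≡m) (sym (length-*ₚ-x²-1 P len-P)))

divisorsBelow : ℕ → ℕ → List ℕ
divisorsBelow m n = map proj₁ (filter (λ x → proj₁ x ∣? m) (below n))

Φ-unfold : ∀ n → Φ n ≡ quotMonic (xⁿ-1 n) (prodₚ (map Φ (divisorsBelow n n)))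
Φ-unfold n = trans (FixPoint.unfold-wfRec <-wellFounded (λ _ → Poly) step step-ext {n})
                   (cong (quotMonic (xⁿ-1 n) ∘′ prodₚ) (map-∘ (filter (λ x → proj₁ x ∣? n) (below n))))
  where
  step : (n : ℕ) → (∀ {d} → d < n → Poly) → Poly
  step n rec = quotMonic (xⁿ-1 n) (prodₚ (map (λ x → rec (proj₂ x)) (filter (λ x → proj₁ x ∣? n) (below n))))

  step-ext : ∀ n {rec rec′ : ∀ {d} → d < n → Poly} →
    (∀ {d} (d<n : d < n) → rec d<n ≡ rec′ d<n) → step n rec ≡ step n rec′
  step-ext n rec≗rec′ =
    cong (quotMonic (xⁿ-1 n) ∘′ prodₚ) (map-cong (λ x → rec≗rec′ (proj₂ x)) (filter (λ x → proj₁ x ∣? n) (below n)))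

divisorsBelow-weaken : ∀ m n (xs : List (Σ ℕ (λ d → d < n))) →
  map proj₁ (filter (λ x → proj₁ x ∣? m) (map (λ x → proj₁ x , ℕ.m<n⇒m<1+n (proj₂ x)) xs))
    ≡ map proj₁ (filter (λ x → proj₁ x ∣? m) xs)
divisorsBelow-weaken m n []       = refl
divisorsBelow-weaken m n (x ∷ xs) with proj₁ x ∣? m
... | yes _ = cong (proj₁ x ∷_) (divisorsBelow-weaken m n xs)
... | no  _ = divisorsBelow-weaken m n xs

divisorsBelow-∣ : ∀ {m n} → n ∣ m → divisorsBelow m (suc n) ≡ n ∷ divisorsBelow m n
divisorsBelow-∣ {m} {n} n∣m =
  trans (cong (map proj₁) (filter-accept (λ x → proj₁ x ∣? m) n∣m)) (cong (n ∷_) (divisorsBelow-weaken m n (below n)))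

divisorsBelow-∤ : ∀ {m n} → ¬ n ∣ m → divisorsBelow m (suc n) ≡ divisorsBelow m n
divisorsBelow-∤ {m} {n} n∤m =
  trans (cong (map proj₁) (filter-reject (λ x → proj₁ x ∣? m) n∤m)) (divisorsBelow-weaken m n (below n))

divisorsBelow-skip : ∀ {m} n k → (∀ j → n ≤ j → j < n + k → ¬ j ∣ m) → divisorsBelow m (n + k) ≡ divisorsBelow m n
divisorsBelow-skip n zero    _     = cong (divisorsBelow _) (ℕ.+-identityʳ n)
divisorsBelow-skip n (suc k) no-div = begin
  divisorsBelow _ (n + suc k) ≡⟨ cong (divisorsBelow _) (ℕ.+-suc n k) ⟩
  divisorsBelow _ (suc (n + k)) ≡⟨ divisorsBelow-∤ (no-div (n + k) (ℕ.m≤m+n n k) n+k<n+1+k) ⟩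
  divisorsBelow _ (n + k) ≡⟨ divisorsBelow-skip n k (λ j n≤j j<n+k → no-div j n≤j (ℕ.<-trans j<n+k n+k<n+1+k)) ⟩
  divisorsBelow _ n ∎
  where
  n+k<n+1+k : n + k < n + suc k
  n+k<n+1+k = ℕ.+-monoʳ-< n (ℕ.n<1+n k)

divisorsBelow-2 : ∀ m .{{_ : NonZero m}} → divisorsBelow m 2 ≡ 1 ∷ []
divisorsBelow-2 m = trans (divisorsBelow-∣ (1∣ m)) (cong (1 ∷_) (divisorsBelow-∤ {m} (ℕ.≢-nonZero⁻¹ m ∘′ 0∣⇒≡0)))

divisorsBelow-prime : ∀ {p} → Prime p → divisorsBelow p p ≡ 1 ∷ []
divisorsBelow-prime {p} p-prime with nonTrivial⇒n>1 p {{prime⇒nonTrivial p-prime}}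
... | s≤s (s≤s {n = k} _) = trans (divisorsBelow-skip 2 k no-divisor) (divisorsBelow-2 p)
  where
  no-divisor : ∀ j → 2 ≤ j → j < 2 + k → ¬ j ∣ p
  no-divisor j 2≤j j<p j∣p with prime⇒irreducible p-prime j∣p
  ... | inj₁ refl = ℕ.<-irrefl refl 2≤j
  ... | inj₂ refl = ℕ.<-irrefl refl j<p

∣2*p⇒≤2⊎≡p : ∀ {p j} → Prime p → j ∣ 2 * p → j < 2 * p → j ≤ 2 ⊎ j ≡ p
∣2*p⇒≤2⊎≡p {p} {j} p-prime (divides e 2p≡e*j) j<2p with euclidsLemma e j p-prime (divides 2 (sym 2p≡e*j))
... | inj₁ (divides b e≡b*p) = inj₁ (∣⇒≤ (divides b (ℕ.*-cancelʳ-≡ 2 (b * j) p 2p≡b*j*p)))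
  where
  instance _ = prime⇒nonZero p-prime
  2p≡b*j*p : 2 * p ≡ b * j * p
  2p≡b*j*p = trans 2p≡e*j (trans (cong (_* j) e≡b*p) (*-xy∙z≈xz∙y b p j))
... | inj₂ (divides a j≡a*p) with ℕ.*-cancelʳ-< p a 2 (subst (_< 2 * p) j≡a*p j<2p)
...   | s≤s z≤n       = contradiction (ℕ.m+n≡0⇒m≡0 p 2p≡0) (ℕ.≢-nonZero⁻¹ p {{prime⇒nonZero p-prime}})
  where
  2p≡0 : 2 * p ≡ 0
  2p≡0 = trans 2p≡e*j (trans (cong (e *_) j≡a*p) (ℕ.*-zeroʳ e))
...   | s≤s (s≤s z≤n) = inj₂ (trans j≡a*p (ℕ.+-identityʳ p))

divisorsBelow-2*prime : ∀ {p} → Prime p → 3 ≤ p → divisorsBelow (2 * p) (2 * p) ≡ p ∷ 2 ∷ 1 ∷ []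
divisorsBelow-2*prime {p} p-prime (s≤s (s≤s (s≤s {n = k} z≤n))) = begin
  divisorsBelow (2 * p) (2 * p)           ≡⟨ cong (divisorsBelow (2 * p)) 2p≡1+p+[2+k] ⟩
  divisorsBelow (2 * p) (suc p + (2 + k)) ≡⟨ divisorsBelow-skip (suc p) (2 + k) above-p ⟩
  divisorsBelow (2 * p) (suc p)           ≡⟨ divisorsBelow-∣ (n∣m*n 2) ⟩
  p ∷ divisorsBelow (2 * p) (3 + k)       ≡⟨ cong (p ∷_) (divisorsBelow-skip 3 k below-p) ⟩
  p ∷ divisorsBelow (2 * p) 3             ≡⟨ cong (p ∷_) (divisorsBelow-∣ (m∣m*n p)) ⟩
  p ∷ 2 ∷ divisorsBelow (2 * p) 2         ≡⟨ cong (λ ds → p ∷ 2 ∷ ds) (divisorsBelow-2 (2 * p)) ⟩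
  p ∷ 2 ∷ 1 ∷ []                          ∎
  where
  2p≡1+p+[2+k] : 2 * p ≡ suc p + (2 + k)
  2p≡1+p+[2+k] = arithmetic k
    where
    arithmetic : ∀ k → 2 * (3 + k) ≡ suc (3 + k) + (2 + k)
    arithmetic = solve-∀

  no-divisor : ∀ j → 3 ≤ j → j ≢ p → j < 2 * p → ¬ j ∣ 2 * p
  no-divisor j 3≤j j≢p j<2p j∣2p with ∣2*p⇒≤2⊎≡p p-prime j∣2p j<2p
  ... | inj₁ j≤2 = ℕ.<⇒≱ 3≤j j≤2
  ... | inj₂ j≡p = j≢p j≡p

  above-p : ∀ j → suc p ≤ j → j < suc p + (2 + k) → ¬ j ∣ 2 * p
  above-p j p<j j<2p = no-divisor j (ℕ.<-trans (s≤s (s≤s (s≤s z≤n))) p<j) (ℕ.<⇒≢ p<j ∘′ sym)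
    (subst (j <_) (sym 2p≡1+p+[2+k]) j<2p)

  below-p : ∀ j → 3 ≤ j → j < 3 + k → ¬ j ∣ 2 * p
  below-p j 3≤j j<p = no-divisor j 3≤j (ℕ.<⇒≢ j<p) (ℕ.<-≤-trans j<p (ℕ.m≤m+n p (p + 0)))

Φ-prime-odd : ∀ {p} → Prime p → OddCoefficients (Φ p) × length (Φ p) ≡ p
Φ-prime-odd {p} p-prime with nonTrivial⇒n>1 p {{prime⇒nonTrivial p-prime}}
... | s≤s {n = suc k} _ = subst (λ P → OddCoefficients P × length P ≡ p) (sym Φp≡) quotient
  where
  Φp≡ : Φ p ≡ quotMonic (xⁿ-1 p) (Φ 1 *ₚ (+ 1 ∷ []))
  Φp≡ = trans (Φ-unfold p) (cong (λ ds → quotMonic (xⁿ-1 p) (prodₚ (map Φ ds))) (divisorsBelow-prime p-prime))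

  quotient = quotMonic-odd {xⁿ-1 p} {Φ 1 *ₚ (+ 1 ∷ [])} (suc k) 1 (trim-xⁿ-1 p) refl refl
    (trans (length-xⁿ-1 p) (cong suc (ℕ.+-comm 1 (suc k))))
    (λ i i≤1+k → coeff₂-reverse-xⁿ-1 p i (s≤s i≤1+k)) (λ { zero _ → refl ; (suc i) _ → refl })

Φ-2*prime-odd : ∀ {p} → Prime p → 3 ≤ p → OddCoefficients (Φ (2 * p)) × length (Φ (2 * p)) ≡ p
Φ-2*prime-odd {p@(suc (suc m))} p-prime 3≤p =
  subst (λ P → OddCoefficients P × length P ≡ p) (sym Φ2p≡) quotient
  where
  -- The product of the smaller cyclotomic factors Φ 2 and Φ 1 evaluates to x²-1.
  Φ2p≡ : Φ (2 * p) ≡ quotMonic (xⁿ-1 (2 * p)) (Φ p *ₚ x²-1)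
  Φ2p≡ = trans (Φ-unfold (2 * p))
    (cong (λ ds → quotMonic (xⁿ-1 (2 * p)) (prodₚ (map Φ ds))) (divisorsBelow-2*prime p-prime 3≤p))

  Φp-odd = proj₁ (Φ-prime-odd p-prime)
  Φp-len = proj₂ (Φ-prime-odd p-prime)

  2p≡1+m+[3+m] : 2 * p ≡ suc m + (3 + m)
  2p≡1+m+[3+m] = arithmetic m
    where
    arithmetic : ∀ m → 2 * (2 + m) ≡ suc m + (3 + m)
    arithmetic = solve-∀

  quotient = quotMonic-odd {xⁿ-1 (2 * p)} {Φ p *ₚ x²-1} (suc m) (3 + m)
    (trim-xⁿ-1 (2 * p)) (trim-*ₚx²-1 m Φp-odd Φp-len) (length-*ₚ-x²-1 (Φ p) Φp-len)
    (trans (length-xⁿ-1 (2 * p)) (cong suc 2p≡1+m+[3+m]))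
    (λ i i≤1+m → coeff₂-reverse-xⁿ-1 (2 * p) i
      (subst (i <_) (sym 2p≡1+m+[3+m]) (ℕ.≤-<-trans i≤1+m (ℕ.m<m+n (suc m) (s≤s z≤n)))))
    (coeff₂-reverse-*ₚx²-1 m Φp-odd Φp-len)

module _ (t i : ℕ) where
  private
    u₁ u₂ u₃ u₄ u₅ u₆ : Poly
    u₁ = mono (+ 2) (4 * t ∸ 1)
    u₂ = mono (+ 1) (2 * t + 4)
    u₃ = mono (+ 2) (2 * t + 1)
    u₄ = mono (+ 2) (2 * t ∸ 1)
    u₅ = mono (+ 1) (2 * t ∸ 4)
    u₆ = mono (+ 2) 1

    even-terms : ∀ a b → 0ℙ ℙ.+ a ℙ.+ 0ℙ ℙ.+ 0ℙ ℙ.+ b ℙ.+ 0ℙ ≡ a ℙ.+ b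
    even-terms a b = trans (ℙ.+-identityʳ _) (cong (ℙ._+ b) (trans (ℙ.+-identityʳ _) (ℙ.+-identityʳ a)))

  coeff₂-U : coeff₂ (U t) i ≡ coeff₂ (mono (+ 1) (2 * t + 4)) i ℙ.+ coeff₂ (mono (+ 1) (2 * t ∸ 4)) i
  coeff₂-U
    rewrite coeff₂--ₚ (u₁ +ₚ u₂ -ₚ u₃ +ₚ u₄ -ₚ u₅) u₆ i | coeff₂--ₚ (u₁ +ₚ u₂ -ₚ u₃ +ₚ u₄) u₅ i
          | coeff₂-+ₚ (u₁ +ₚ u₂ -ₚ u₃) u₄ i | coeff₂--ₚ (u₁ +ₚ u₂) u₃ i | coeff₂-+ₚ u₁ u₂ i
          | coeff₂-mono-even (+ 2) (4 * t ∸ 1) i refl | coeff₂-mono-even (+ 2) (2 * t + 1) i refl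
          | coeff₂-mono-even (+ 2) (2 * t ∸ 1) i refl | coeff₂-mono-even (+ 2) 1 i refl
          = even-terms (coeff₂ u₂ i) (coeff₂ u₅ i)

  coeff₂-W : coeff₂ (W t) i ≡ coeff₂ (mono (+ 1) (2 * t + 4)) i ℙ.+ coeff₂ (mono (+ 1) (2 * t ∸ 4)) i
  coeff₂-W
    rewrite coeff₂--ₚ (u₁ -ₚ u₂ -ₚ u₃ +ₚ u₄ +ₚ u₅) u₆ i | coeff₂-+ₚ (u₁ -ₚ u₂ -ₚ u₃ +ₚ u₄) u₅ i
          | coeff₂-+ₚ (u₁ -ₚ u₂ -ₚ u₃) u₄ i | coeff₂--ₚ (u₁ -ₚ u₂) u₃ i | coeff₂--ₚ u₁ u₂ i
          | coeff₂-mono-even (+ 2) (4 * t ∸ 1) i refl | coeff₂-mono-even (+ 2) (2 * t + 1) i refl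
          | coeff₂-mono-even (+ 2) (2 * t ∸ 1) i refl | coeff₂-mono-even (+ 2) 1 i refl
          = even-terms (coeff₂ u₂ i) (coeff₂ u₅ i)

prime>3⇒∤8 : ∀ {p} → Prime p → 3 < p → ¬ p ∣ 8
prime>3⇒∤8 p-prime 3<p p∣8 with euclidsLemma 2 4 p-prime p∣8
... | inj₁ p∣2 = >⇒∤ (ℕ.<-trans (ℕ.n<1+n 2) 3<p) p∣2
... | inj₂ p∣4 = [ >⇒∤ 2<p , >⇒∤ 2<p ]′ (euclidsLemma 2 2 p-prime p∣4)
  where
  2<p = ℕ.<-trans (ℕ.n<1+n 2) 3<p

prime>3⇒∤9 : ∀ {p} → Prime p → 3 < p → ¬ p ∣ 9
prime>3⇒∤9 p-prime 3<p p∣9 = [ >⇒∤ 3<p , >⇒∤ 3<p ]′ (euclidsLemma 3 3 p-prime p∣9)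

lemma16 : (t : ℕ) → 2 ≤ t → (p : ℕ) → Prime p → 7 ≤ p →
    (¬ (Φ p ∣ₚ U t)) × (¬ (Φ (2 * p) ∣ₚ U t)) × (¬ (Φ p ∣ₚ W t)) × (¬ (Φ (2 * p) ∣ₚ W t))
lemma16 t 2≤t p p-prime 7≤p =
  ¬∣ Φp (U t) (coeff₂-U t) , ¬∣ Φ2p (U t) (coeff₂-U t) , ¬∣ Φp (W t) (coeff₂-W t) , ¬∣ Φ2p (W t) (coeff₂-W t)
  where
  3<p : 3 < p
  3<p = ℕ.<-≤-trans (s≤s (s≤s (s≤s (s≤s z≤n)))) 7≤p

  Φp  = Φ-prime-odd p-prime
  Φ2p = Φ-2*prime-odd p-prime (ℕ.<⇒≤ 3<p)

  a+8≡2t+4 : 2 * t ∸ 4 + 8 ≡ 2 * t + 4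
  a+8≡2t+4 = trans (sym (ℕ.+-assoc (2 * t ∸ 4) 4 4)) (cong (_+ 4) (ℕ.m∸n+n≡m (ℕ.*-monoʳ-≤ 2 2≤t)))

  ¬∣ : ∀ {P} → OddCoefficients P × length P ≡ p → ∀ f →
    (∀ i → coeff₂ f i ≡ coeff₂ (mono (+ 1) (2 * t + 4)) i ℙ.+ coeff₂ (mono (+ 1) (2 * t ∸ 4)) i) → ¬ P ∣ₚ f
  ¬∣ (P-odd , len-P) f = ¬odd∣twoTerms {f = f} (2 * t ∸ 4) 8 a+8≡2t+4 P-odd len-P
    (ℕ.<-trans (s≤s (s≤s z≤n)) 3<p) (prime>3⇒∤8 p-prime 3<p) (prime>3⇒∤9 p-prime 3<p)
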